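{- (Distribution factorisation.) Let $K$ be a set, let $\mathsf{D}_K$ be the category described in the context, and let $A,B,C,D$ be syntactic propositions over $K$. Then every $\mathsf{D}_K$ morphism $R:A\wedge(B\vee C)\to D$ factorises through the distribution $d:A\wedge(B\vee C)\to(A\wedge B)\vee(A\wedge C)$, i.e. there exists a $\mathsf{D}_K$ morphism $R':(A\wedge B)\vee(A\wedge C)\to D$ with $R=d;R'$ (first $d$, then $R'$).
   Context: For subsets $s,t$ of a set $X$, $s\perp t$ means $s\cap t$ has exactly one element; $S^{\perp}=\{t\subseteq X: t\perp s\ \forall s\in S\}$. A syntactic proposition over $K$ arises from a formula $\phi$ built from elements of $K$ with binary $\wedge,\vee$: it is the pair $(X,S)$ with $X$ the set of leaf occurrences of $\phi$ (labelled by elements of $K$) and $S$ (the resolutions) the set of maximal sets of leaves no two of which meet at a $\wedge$-node of the parse tree. Sum: $(X,S)\vee(Y,T)=(X+Y,\{s+t:s\in S,t\in T\})$; product: $(X,S)\wedge(Y,T)=(X+Y,S\cup T)$. The category $\mathsf{D}_K$ has syntactic propositions as objects; a morphism $(X,S)\to(Y,T)$ is a label-respecting relation $R\subseteq X\times Y$ such that for every $t\in T$, $R^{ -1}(t)=\{x:\exists y\in t,\ xRy\}$ contains an element of $S$, and for every $\alpha\in S^{\perp}$, $R(\alpha)=\{y:\exists x\in\alpha,\ xRy\}$ contains an element of $T^{\perp}$; composition is relational composition. The distribution $d$ is the relation relating each leaf of $A$ to both of its copies (in $A\wedge B$ and in $A\wedge C$), each leaf of $B$ to its copy in $A\wedge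 B$, and each leaf of $C$ to its copy in $A\wedge C$. -}

module Defs where

open import Data.Bool using (Bool; true; false; _∧_; if_then_else_)
open import Data.Unit using (⊤; tt)
open import Data.Sum using (_⊎_; inj₁; inj₂)
open import Data.Product using (Σ; _×_; _,_; ∃; ∃-syntax)
open import Relation.Binary.PropositionalEquality using (_≡_)

data Form (K : Set) : Set where
  lf    : K → Form K
  _∧ᶠ_  : Form K → Form K → Form K
  _∨ᶠ_  : Form K → Form K → Form K

infixr 6 _∧ᶠ_
infixr 5 _∨ᶠ_

_⨾_ : {X Y Z : Set} → (X → Y → Bool) → (Y → Z → Bool) → X → Z → Set
(R ⨾ R') x z = ∃[ y ] (R x y ≡ true × R' y z ≡ true)

module _ {K : Set} where

  -- X : the set of leaf occurrences (X + Y = disjoint union)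
  Leaf : Form K → Set
  Leaf (lf k)   = ⊤
  Leaf (φ ∧ᶠ ψ) = Leaf φ ⊎ Leaf ψ
  Leaf (φ ∨ᶠ ψ) = Leaf φ ⊎ Leaf ψ

  label : (φ : Form K) → Leaf φ → K
  label (lf k)   _        = k
  label (φ ∧ᶠ ψ) (inj₁ x) = label φ x
  label (φ ∧ᶠ ψ) (inj₂ y) = label ψ y
  label (φ ∨ᶠ ψ) (inj₁ x) = label φ x
  label (φ ∨ᶠ ψ) (inj₂ y) = label ψ y

  Subset : Set → Set
  Subset X = X → Bool

  Empty : {X : Set} → Subset X → Set
  Empty s = ∀ x → s x ≡ false

  _⊆_ : {X : Set} → Subset X → Subset X → Set
  s ⊆ t = ∀ x → s x ≡ true → t x ≡ true

  _⊥_ : {X : Set} → Subset X → Subset X → Set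
  s ⊥ t = ∃[ x ] ((s x ∧ t x) ≡ true × (∀ y → (s y ∧ t y) ≡ true → y ≡ x))

  -- Resolutions S of the syntactic proposition of φ, built compositionally:
  -- leaf: {{x}};  (X,S) ∨ (Y,T): {s + t};  (X,S) ∧ (Y,T): S ∪ T (inside X + Y).
  IsRes : (φ : Form K) → Subset (Leaf φ) → Set
  IsRes (lf k)   s = s tt ≡ true
  IsRes (φ ∨ᶠ ψ) s = IsRes φ (λ x → s (inj₁ x)) × IsRes ψ (λ y → s (inj₂ y))
  IsRes (φ ∧ᶠ ψ) s =
      (IsRes φ (λ x → s (inj₁ x)) × Empty (λ y → s (inj₂ y)))
    ⊎ (Empty (λ x → s (inj₁ x)) × IsRes ψ (λ y → s (inj₂ y)))

  Perp : (φ : Form K) → Subset (Leaf φ) → Set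
  Perp φ α = ∀ s → IsRes φ s → α ⊥ s

  -- relations R ⊆ X × Y (finite, hence Bool-valued)
  Rel : Set → Set → Set
  Rel X Y = X → Y → Bool

  preimg : {X Y : Set} → Rel X Y → Subset Y → X → Set
  preimg R t x = ∃[ y ] (t y ≡ true × R x y ≡ true)

  img : {X Y : Set} → Rel X Y → Subset X → Y → Set
  img R α y = ∃[ x ] (α x ≡ true × R x y ≡ true)

  record Hom (φ ψ : Form K) : Set where
    field
      rel      : Rel (Leaf φ) (Leaf ψ)
      labelled : ∀ x y → rel x y ≡ true → label φ x ≡ label ψ y
      cond-res : ∀ t → IsRes ψ t →
                 ∃[ s ] (IsRes φ s × (∀ x → s x ≡ true → preimg rel t x))
      cond-perp : ∀ α → Perp φ α →
                 ∃[ β ] (Perp ψ β × (∀ y → β y ≡ true → img rel α y))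
  open Hom public

  eqLeaf : (φ : Form K) → Leaf φ → Leaf φ → Bool
  eqLeaf (lf k)   _ _ = true
  eqLeaf (φ ∧ᶠ ψ) (inj₁ x) (inj₁ x') = eqLeaf φ x x'
  eqLeaf (φ ∧ᶠ ψ) (inj₂ y) (inj₂ y') = eqLeaf ψ y y'
  eqLeaf (φ ∧ᶠ ψ) _ _ = false
  eqLeaf (φ ∨ᶠ ψ) (inj₁ x) (inj₁ x') = eqLeaf φ x x'
  eqLeaf (φ ∨ᶠ ψ) (inj₂ y) (inj₂ y') = eqLeaf ψ y y'
  eqLeaf (φ ∨ᶠ ψ) _ _ = false

  dist : (A B C : Form K) →
         Rel (Leaf (A ∧ᶠ (B ∨ᶠ C))) (Leaf ((A ∧ᶠ B) ∨ᶠ (A ∧ᶠ C)))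
  dist A B C (inj₁ a)        (inj₁ (inj₁ a')) = eqLeaf A a a'
  dist A B C (inj₁ a)        (inj₂ (inj₁ a')) = eqLeaf A a a'
  dist A B C (inj₂ (inj₁ b)) (inj₁ (inj₂ b')) = eqLeaf B b b'
  dist A B C (inj₂ (inj₂ c)) (inj₂ (inj₂ c')) = eqLeaf C c c'
  dist A B C _ _ = false

{-# OPTIONS --safe #-}
-- Every leaf of (A ∧ B) ∨ (A ∧ C) is a copy of a unique leaf of A ∧ (B ∨ C); write
-- copyOf for this surjection, so that d is the converse of its graph.  Hence
-- R' := R ∘ copyOf satisfies d ⨾ R' = R, and R' is a morphism: copyOf pulls
-- resolutions back to resolutions, and pushes each α ∈ S^⊥ forward to copyOf(α) ∈ S^⊥,
-- since the only point of α ∩ copyOf⁻¹(s) is mapped to the only point of copyOf(α) ∩ s.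
module Submission where

open import Defs
open import Data.Bool using (Bool; true; false; _∧_; _∨_)
open import Data.Bool.Properties using (∨-zeroʳ)
open import Data.Product using (Σ; _×_; _,_; ∃-syntax)
open import Data.Sum using (_⊎_; inj₁; inj₂)
open import Data.Unit using (tt)
open import Function using (_∘_)
open import Function.Bundles using (_⇔_; mk⇔; Equivalence)
open import Relation.Binary.PropositionalEquality using (_≡_; refl; sym; trans; cong; subst)

∧-true-intro : ∀ {a b} → a ≡ true → b ≡ true → (a ∧ b) ≡ true
∧-true-intro refl q = q

∧-true-elim : ∀ a {b} → (a ∧ b) ≡ true → a ≡ true × b ≡ true
∧-true-elim true  p = refl , p
∧-true-elim false ()

∨-true-elim : ∀ a {b} → (a ∨ b) ≡ true → a ≡ true ⊎ b ≡ true
∨-true-elim true  _ = inj₁ refl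
∨-true-elim false p = inj₂ p

⨾-converse-graph : {X Y Z : Set} (S : X → Y → Bool) (f : Y → X) →
  (∀ x y → S x y ≡ true → x ≡ f y) → (∀ x → ∃[ y ] S x y ≡ true) →
  (R : X → Z → Bool) → ∀ x z → R x z ≡ true ⇔ (S ⨾ (R ∘ f)) x z
⨾-converse-graph S f S⊆graph S-total R x z = mk⇔ to from
  where
  to : R x z ≡ true → (S ⨾ (R ∘ f)) x z
  to p with S-total x
  ... | y , Sxy = y , Sxy , subst (λ w → R w z ≡ true) (S⊆graph x y Sxy) p

  from : (S ⨾ (R ∘ f)) x z → R x z ≡ true
  from (y , Sxy , q) = subst (λ w → R w z ≡ true) (sym (S⊆graph x y Sxy)) q

IsImage : {X Y : Set} → (Y → X) → (Y → Bool) → (X → Bool) → Set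
IsImage f α β = ∀ x → β x ≡ true ⇔ (∃[ y ] (f y ≡ x × α y ≡ true))

module _ {K : Set} where

  eqLeaf-refl : (φ : Form K) (x : Leaf φ) → eqLeaf φ x x ≡ true
  eqLeaf-refl (lf k)   x        = refl
  eqLeaf-refl (φ ∧ᶠ ψ) (inj₁ x) = eqLeaf-refl φ x
  eqLeaf-refl (φ ∧ᶠ ψ) (inj₂ y) = eqLeaf-refl ψ y
  eqLeaf-refl (φ ∨ᶠ ψ) (inj₁ x) = eqLeaf-refl φ x
  eqLeaf-refl (φ ∨ᶠ ψ) (inj₂ y) = eqLeaf-refl ψ y

  eqLeaf⇒≡ : (φ : Form K) (x x′ : Leaf φ) → eqLeaf φ x x′ ≡ true → x ≡ x′
  eqLeaf⇒≡ (lf k)   tt       tt        _ = refl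
  eqLeaf⇒≡ (φ ∧ᶠ ψ) (inj₁ x) (inj₁ x′) p = cong inj₁ (eqLeaf⇒≡ φ x x′ p)
  eqLeaf⇒≡ (φ ∧ᶠ ψ) (inj₂ y) (inj₂ y′) p = cong inj₂ (eqLeaf⇒≡ ψ y y′ p)
  eqLeaf⇒≡ (φ ∧ᶠ ψ) (inj₁ _) (inj₂ _)  ()
  eqLeaf⇒≡ (φ ∧ᶠ ψ) (inj₂ _) (inj₁ _)  ()
  eqLeaf⇒≡ (φ ∨ᶠ ψ) (inj₁ x) (inj₁ x′) p = cong inj₁ (eqLeaf⇒≡ φ x x′ p)
  eqLeaf⇒≡ (φ ∨ᶠ ψ) (inj₂ y) (inj₂ y′) p = cong inj₂ (eqLeaf⇒≡ ψ y y′ p)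
  eqLeaf⇒≡ (φ ∨ᶠ ψ) (inj₁ _) (inj₂ _)  ()
  eqLeaf⇒≡ (φ ∨ᶠ ψ) (inj₂ _) (inj₁ _)  ()

  module Precompose {φ ψ : Form K} (f : Leaf ψ → Leaf φ)
    (label-f : ∀ y → label ψ y ≡ label φ (f y))
    (IsRes-∘f : ∀ s → IsRes φ s → IsRes ψ (s ∘ f))
    (image : (Leaf ψ → Bool) → Leaf φ → Bool)
    (image-isImage : ∀ α → IsImage f α (image α))
    where

    ∈-image : ∀ {α y} → α y ≡ true → image α (f y) ≡ true
    ∈-image {α} {y} αy = Equivalence.from (image-isImage α (f y)) (y , refl , αy)

    image-preimage : ∀ {α x} → image α x ≡ true → ∃[ y ] (f y ≡ x × α y ≡ true)
    image-preimage {α} {x} = Equivalence.to (image-isImage α x)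

    image-⊥ : ∀ α s → _⊥_ {K = K} α (s ∘ f) → _⊥_ {K = K} (image α) s
    image-⊥ α s (y , αy∧sfy , unique) with ∧-true-elim (α y) αy∧sfy
    ... | αy , sfy = f y , ∧-true-intro (∈-image αy) sfy , unique-image
      where
      unique-image : ∀ x → (image α x ∧ s x) ≡ true → x ≡ f y
      unique-image x p with ∧-true-elim (image α x) p
      ... | βx , sx with image-preimage βx
      ... | y′ , refl , αy′ = cong f (unique y′ (∧-true-intro αy′ sx))

    Perp-image : ∀ α → Perp ψ α → Perp φ (image α)
    Perp-image α α-perp s s-res = image-⊥ α s (α-perp (s ∘ f) (IsRes-∘f s s-res))

    img-image : ∀ {Z} (R : Leaf φ → Z → Bool) α z →
                img {K = K} R (image α) z → img {K = K} (R ∘ f) α z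
    img-image R α z (x , βx , Rxz) with image-preimage βx
    ... | y , refl , αy = y , αy , Rxz

    precompose : ∀ {D} → Hom φ D → Hom ψ D
    rel (precompose R) = rel R ∘ f
    labelled (precompose R) y z p rewrite label-f y = labelled R (f y) z p
    cond-res (precompose R) t t-res =
      let s , s-res , s⊆R⁻¹t = cond-res R t t-res
      in  s ∘ f , IsRes-∘f s s-res , s⊆R⁻¹t ∘ f
    cond-perp (precompose R) α α-perp =
      let β , β-perp , β⊆Rα = cond-perp R (image α) (Perp-image α α-perp)
      in  β , β-perp , λ z βz → img-image (rel R) α z (β⊆Rα z βz)

module Distribution {K : Set} (A B C : Form K) where

  copyOf : Leaf ((A ∧ᶠ B) ∨ᶠ (A ∧ᶠ C)) → Leaf (A ∧ᶠ (B ∨ᶠ C))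
  copyOf (inj₁ (inj₁ a)) = inj₁ a
  copyOf (inj₁ (inj₂ b)) = inj₂ (inj₁ b)
  copyOf (inj₂ (inj₁ a)) = inj₁ a
  copyOf (inj₂ (inj₂ c)) = inj₂ (inj₂ c)

  label-copyOf : ∀ y → label ((A ∧ᶠ B) ∨ᶠ (A ∧ᶠ C)) y ≡ label (A ∧ᶠ (B ∨ᶠ C)) (copyOf y)
  label-copyOf (inj₁ (inj₁ a)) = refl
  label-copyOf (inj₁ (inj₂ b)) = refl
  label-copyOf (inj₂ (inj₁ a)) = refl
  label-copyOf (inj₂ (inj₂ c)) = refl

  IsRes-∘copyOf : ∀ s → IsRes (A ∧ᶠ (B ∨ᶠ C)) s → IsRes ((A ∧ᶠ B) ∨ᶠ (A ∧ᶠ C)) (s ∘ copyOf)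
  IsRes-∘copyOf s (inj₁ (a-res , bc-empty)) =
    inj₁ (a-res , bc-empty ∘ inj₁) , inj₁ (a-res , bc-empty ∘ inj₂)
  IsRes-∘copyOf s (inj₂ (a-empty , b-res , c-res)) =
    inj₂ (a-empty , b-res) , inj₂ (a-empty , c-res)

  copyOf-image : (Leaf ((A ∧ᶠ B) ∨ᶠ (A ∧ᶠ C)) → Bool) → Leaf (A ∧ᶠ (B ∨ᶠ C)) → Bool
  copyOf-image α (inj₁ a)        = α (inj₁ (inj₁ a)) ∨ α (inj₂ (inj₁ a))
  copyOf-image α (inj₂ (inj₁ b)) = α (inj₁ (inj₂ b))
  copyOf-image α (inj₂ (inj₂ c)) = α (inj₂ (inj₂ c))

  copyOf-image-isImage : ∀ α → IsImage copyOf α (copyOf-image α)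
  copyOf-image-isImage α x = mk⇔ (preimage x) (λ { (y , refl , αy) → ∈-image y αy })
    where
    preimage : ∀ x → copyOf-image α x ≡ true → ∃[ y ] (copyOf y ≡ x × α y ≡ true)
    preimage (inj₁ a) p with ∨-true-elim (α (inj₁ (inj₁ a))) p
    ... | inj₁ q = inj₁ (inj₁ a) , refl , q
    ... | inj₂ q = inj₂ (inj₁ a) , refl , q
    preimage (inj₂ (inj₁ b)) p = inj₁ (inj₂ b) , refl , p
    preimage (inj₂ (inj₂ c)) p = inj₂ (inj₂ c) , refl , p

    ∈-image : ∀ y → α y ≡ true → copyOf-image α (copyOf y) ≡ true
    ∈-image (inj₁ (inj₁ a)) p = cong (_∨ α (inj₂ (inj₁ a))) p
    ∈-image (inj₁ (inj₂ b)) p = p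
    ∈-image (inj₂ (inj₁ a)) p = trans (cong (α (inj₁ (inj₁ a)) ∨_) p) (∨-zeroʳ _)
    ∈-image (inj₂ (inj₂ c)) p = p

  dist⇒copyOf : ∀ x y → dist A B C x y ≡ true → x ≡ copyOf y
  dist⇒copyOf (inj₁ a)        (inj₁ (inj₁ a′)) p = cong inj₁ (eqLeaf⇒≡ A a a′ p)
  dist⇒copyOf (inj₁ a)        (inj₂ (inj₁ a′)) p = cong inj₁ (eqLeaf⇒≡ A a a′ p)
  dist⇒copyOf (inj₂ (inj₁ b)) (inj₁ (inj₂ b′)) p = cong (inj₂ ∘ inj₁) (eqLeaf⇒≡ B b b′ p)
  dist⇒copyOf (inj₂ (inj₂ c)) (inj₂ (inj₂ c′)) p = cong (inj₂ ∘ inj₂) (eqLeaf⇒≡ C c c′ p)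
  dist⇒copyOf (inj₁ _)        (inj₁ (inj₂ _))  ()
  dist⇒copyOf (inj₁ _)        (inj₂ (inj₂ _))  ()
  dist⇒copyOf (inj₂ (inj₁ _)) (inj₁ (inj₁ _))  ()
  dist⇒copyOf (inj₂ (inj₁ _)) (inj₂ (inj₁ _))  ()
  dist⇒copyOf (inj₂ (inj₁ _)) (inj₂ (inj₂ _))  ()
  dist⇒copyOf (inj₂ (inj₂ _)) (inj₁ (inj₁ _))  ()
  dist⇒copyOf (inj₂ (inj₂ _)) (inj₁ (inj₂ _))  ()
  dist⇒copyOf (inj₂ (inj₂ _)) (inj₂ (inj₁ _))  ()

  dist-total : ∀ x → ∃[ y ] dist A B C x y ≡ true
  dist-total (inj₁ a)        = inj₁ (inj₁ a) , eqLeaf-refl A a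
  dist-total (inj₂ (inj₁ b)) = inj₁ (inj₂ b) , eqLeaf-refl B b
  dist-total (inj₂ (inj₂ c)) = inj₂ (inj₂ c) , eqLeaf-refl C c

lemma1 : (K : Set) (A B C D : Form K) (R : Hom (A ∧ᶠ (B ∨ᶠ C)) D) →
    Σ (Hom ((A ∧ᶠ B) ∨ᶠ (A ∧ᶠ C)) D) (λ R' →
      ∀ x z → (rel R x z ≡ true) ⇔ (dist A B C ⨾ rel R') x z)
lemma1 _ A B C D R =
  precompose R , ⨾-converse-graph (dist A B C) copyOf dist⇒copyOf dist-total (rel R)
  where
  open Distribution A B C
  open Precompose copyOf label-copyOf IsRes-∘copyOf copyOf-image copyOf-image-isImage
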